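{- Let $\mathbf d=(d_1,\dots,d_k)$ be a list of integers with $d_i\ge3$ for all $i$ and $\sum_i d_i=2n$. For $I\subset\{1,\dots,k\}$ let $\mathrm{vol}(I)=\sum_{i\in I}d_i$, and let $N_V(\mathbf d)$ be the number of sets $I\subset\{1,\dots,k\}$ with $\mathrm{vol}(I)=V$. Then for every integer $0<V\le n$, \[N_V(\mathbf d)\le \left\lfloor \tfrac V3\right\rfloor\binom{\lfloor 2n/3\rfloor}{\lfloor V/3\rfloor}.\] -}

module Defs where

open import Data.Nat using (ℕ; zero; suc; _+_; _≟_)
open import Data.List using (List; []; _∷_; map; _++_; length; filter)
open import Data.Vec using (Vec; []; _∷_)
open import Data.Fin.Subset using (Subset; Side; inside; outside)
open import Relation.Binary.PropositionalEquality using (_≡_)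

allSubsets : (k : ℕ) → List (Subset k)
allSubsets zero    = [] ∷ []
allSubsets (suc k) = map (outside ∷_) (allSubsets k) ++ map (inside ∷_) (allSubsets k)

vol : {k : ℕ} → Vec ℕ k → Subset k → ℕ
vol []       []            = 0
vol (d ∷ ds) (inside ∷ I)  = d + vol ds I
vol (d ∷ ds) (outside ∷ I) = vol ds I

N : {k : ℕ} → Vec ℕ k → ℕ → ℕ
N {k} d V = length (filter (λ I → vol d I ≟ V) (allSubsets k))

-- Deleting the first part d splits the subsets of volume V into those avoiding it (volume V in the
-- remaining list) and those containing it (volume V ∸ d): N obeys a Pascal-type recurrence. As every
-- part is at least 3, induction on k along it, matched against Pascal's rule for partial binomial
-- sums, bounds N_V(d) by Σ_{j=1}^{⌊V/3⌋} C(k, j). Finally 3k ≤ Σ d = 2n gives k ≤ ⌊2n/3⌋, and since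
-- 2⌊V/3⌋ ≤ ⌊2n/3⌋ the summands increase up to j = ⌊V/3⌋, so the sum is at most ⌊V/3⌋ C(⌊2n/3⌋, ⌊V/3⌋).
module Submission where

open import Defs
open import Data.Nat using (ℕ; _≤_; _<_; _*_; _/_)
open import Data.Nat.Combinatorics using (_C_)
open import Data.Vec using (Vec; sum)
open import Data.Vec.Relation.Unary.All using (All)
open import Relation.Binary.PropositionalEquality using (_≡_)

open import Data.Nat using (zero; suc; _+_; _∸_; _≟_; z≤n; s≤s; _<?_; _≤′_; ≤′-refl; ≤′-step)
open import Data.Nat.Properties
open import Data.Nat.DivMod using (m/n≡1+[m∸n]/n; /-monoˡ-≤; m*n/n≡m; m/n*n≤m)
open import Data.Nat.Combinatorics using (nC1≡n; nCk+nC[k+1]≡[n+1]C[k+1])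
open import Data.Nat.Tactic.RingSolver using (solve-∀)
open import Data.Bool using (true; false)
open import Data.Empty using (⊥)
open import Data.Product using (_,_)
open import Data.List using (List; []; _∷_; map; _++_; length; filter)
open import Data.List.Properties using (filter-++; length-++; filter-none; filter-≐)
open import Data.List.Relation.Unary.All using (universal)
open import Data.Vec using ([]; _∷_)
open import Data.Vec.Relation.Unary.All using ([]; _∷_)
import Data.Vec.Relation.Unary.All as All
open import Data.Fin.Subset using (Subset; inside; outside)
open import Function using (_∘_)
open import Level using (0ℓ)
open import Relation.Nullary using (does; yes; no)
open import Relation.Unary using (Pred; Decidable)
open import Relation.Binary.PropositionalEquality
  using (refl; sym; trans; cong; cong₂; subst; module ≡-Reasoning)

mono-≤-from-suc : (f : ℕ → ℕ) → (∀ n → f n ≤ f (suc n)) → ∀ {m n} → m ≤ n → f m ≤ f n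
mono-≤-from-suc f f≤f∘suc m≤n = go (≤⇒≤′ m≤n)
  where
  go : ∀ {m n} → m ≤′ n → f m ≤ f n
  go ≤′-refl        = ≤-refl
  go (≤′-step m≤′n) = ≤-trans (go m≤′n) (f≤f∘suc _)

[k+1]*[n+1]C[k+1]≡[n+1]*nCk : ∀ n k → suc k * (suc n C suc k) ≡ suc n * (n C k)
[k+1]*[n+1]C[k+1]≡[n+1]*nCk n       zero    =
  trans (+-identityʳ _) (trans (nC1≡n (suc n)) (sym (*-identityʳ (suc n))))
[k+1]*[n+1]C[k+1]≡[n+1]*nCk zero    (suc k) = *-zeroʳ (suc (suc k))
[k+1]*[n+1]C[k+1]≡[n+1]*nCk (suc n) (suc k) = begin
    suc (suc k) * (suc (suc n) C suc (suc k))
  ≡⟨ cong (suc (suc k) *_) (sym (nCk+nC[k+1]≡[n+1]C[k+1] (suc n) (suc k))) ⟩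
    suc (suc k) * (a + b)
  ≡⟨ *-distribˡ-+ (suc (suc k)) a b ⟩
    a + suc k * a + suc (suc k) * b
  ≡⟨ cong₂ (λ x y → a + x + y) ([k+1]*[n+1]C[k+1]≡[n+1]*nCk n k)
                                ([k+1]*[n+1]C[k+1]≡[n+1]*nCk n (suc k)) ⟩
    a + suc n * (n C k) + suc n * (n C suc k)
  ≡⟨ +-assoc a _ _ ⟩
    a + (suc n * (n C k) + suc n * (n C suc k))
  ≡⟨ cong (a +_) (sym (*-distribˡ-+ (suc n) (n C k) (n C suc k))) ⟩
    a + suc n * (n C k + n C suc k)
  ≡⟨ cong (λ x → a + suc n * x) (nCk+nC[k+1]≡[n+1]C[k+1] n k) ⟩
    suc (suc n) * a
  ∎
  where
  open ≡-Reasoning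
  a b : ℕ
  a = suc n C suc k
  b = suc n C suc (suc k)

nCk≤nC[k+1] : ∀ {n k} → 2 * k < n → n C k ≤ n C suc k
nCk≤nC[k+1] {n} {k} 2k<n = *-cancelˡ-≤ (suc k) (+-cancelʳ-≤ (suc k * (n C k)) _ _ (begin
    suc k * (n C k) + suc k * (n C k)
  ≡⟨ sym (*-distribʳ-+ (n C k) (suc k) (suc k)) ⟩
    (suc k + suc k) * (n C k)
  ≤⟨ *-monoˡ-≤ (n C k) 2[k+1]≤n+1 ⟩
    suc n * (n C k)
  ≡⟨ sym ([k+1]*[n+1]C[k+1]≡[n+1]*nCk n k) ⟩
    suc k * (suc n C suc k)
  ≡⟨ cong (suc k *_) (sym (nCk+nC[k+1]≡[n+1]C[k+1] n k)) ⟩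
    suc k * (n C k + n C suc k)
  ≡⟨ *-distribˡ-+ (suc k) (n C k) (n C suc k) ⟩
    suc k * (n C k) + suc k * (n C suc k)
  ≡⟨ +-comm (suc k * (n C k)) _ ⟩
    suc k * (n C suc k) + suc k * (n C k)
  ∎))
  where
  open ≤-Reasoning
  2[k+1]≤n+1 : suc k + suc k ≤ suc n
  2[k+1]≤n+1 = s≤s (subst (_≤ n) (trans (cong (suc k +_) (+-identityʳ k)) (sym (+-suc k k))) 2k<n)

binomialSum : ℕ → ℕ → ℕ
binomialSum n zero    = 0
binomialSum n (suc m) = binomialSum n m + n C suc m

binomialSum-pascal : ∀ n m → binomialSum (suc n) (suc m) ≡ binomialSum n (suc m) + suc (binomialSum n m)
binomialSum-pascal n zero    = trans (sym (nCk+nC[k+1]≡[n+1]C[k+1] n 0)) (+-comm 1 (n C 1))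
binomialSum-pascal n (suc m) = begin
    binomialSum (suc n) (suc m) + suc n C suc (suc m)
  ≡⟨ cong₂ _+_ (binomialSum-pascal n m) (sym (nCk+nC[k+1]≡[n+1]C[k+1] n (suc m))) ⟩
    (s + suc t) + (n C suc m + n C suc (suc m))
  ≡⟨ rearrange s t (n C suc m) (n C suc (suc m)) ⟩
    (s + n C suc (suc m)) + suc (t + n C suc m)
  ∎
  where
  open ≡-Reasoning
  rearrange : ∀ a b c d → (a + suc b) + (c + d) ≡ (a + d) + suc (b + c)
  rearrange = solve-∀
  s t : ℕ
  s = binomialSum n (suc m)
  t = binomialSum n m

nCk≤[n+1]Ck : ∀ n k → n C k ≤ suc n C k
nCk≤[n+1]Ck n zero    = ≤-refl
nCk≤[n+1]Ck n (suc k) = subst (n C suc k ≤_) (nCk+nC[k+1]≡[n+1]C[k+1] n k) (m≤n+m _ _)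

binomialSum-monoˡ-≤ : ∀ m {n n′} → n ≤ n′ → binomialSum n m ≤ binomialSum n′ m
binomialSum-monoˡ-≤ m = mono-≤-from-suc (λ n → binomialSum n m) (step m)
  where
  step : ∀ m n → binomialSum n m ≤ binomialSum (suc n) m
  step zero    n = z≤n
  step (suc m) n = +-mono-≤ (step m n) (nCk≤[n+1]Ck n (suc m))

binomialSum-monoʳ-≤ : ∀ n {m m′} → m ≤ m′ → binomialSum n m ≤ binomialSum n m′
binomialSum-monoʳ-≤ n = mono-≤-from-suc (binomialSum n) (λ m → m≤m+n _ _)

binomialSum≤m*nCm : ∀ {n} m → 2 * m ≤ n → binomialSum n m ≤ m * (n C m)
binomialSum≤m*nCm       zero    _      = z≤n
binomialSum≤m*nCm {n} (suc m) 2m+2≤n = begin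
    binomialSum n m + n C suc m
  ≤⟨ +-monoˡ-≤ _ (binomialSum≤m*nCm m (≤-trans (*-monoʳ-≤ 2 (n≤1+n m)) 2m+2≤n)) ⟩
    m * (n C m) + n C suc m
  ≤⟨ +-monoˡ-≤ _ (*-monoʳ-≤ m (nCk≤nC[k+1] (<-≤-trans (*-monoʳ-< 2 (n<1+n m)) 2m+2≤n))) ⟩
    m * (n C suc m) + n C suc m
  ≡⟨ +-comm (m * (n C suc m)) _ ⟩
    suc m * (n C suc m)
  ∎
  where open ≤-Reasoning

length-filter-map : ∀ {A B : Set} {P : Pred A 0ℓ} (P? : Decidable P) (f : B → A) (xs : List B) →
                    length (filter P? (map f xs)) ≡ length (filter (P? ∘ f) xs)
length-filter-map P? f []       = refl
length-filter-map P? f (x ∷ xs) with does (P? (f x))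
... | true  = cong suc (length-filter-map P? f xs)
... | false = length-filter-map P? f xs

N-∷ : ∀ {k} d (ds : Vec ℕ k) V →
      N (d ∷ ds) V ≡ N ds V + length (filter (λ I → d + vol ds I ≟ V) (allSubsets k))
N-∷ {k} d ds V = begin
    length (filter P? (map (outside ∷_) Is ++ map (inside ∷_) Is))
  ≡⟨ cong length (filter-++ P? (map (outside ∷_) Is) _) ⟩
    length (filter P? (map (outside ∷_) Is) ++ filter P? (map (inside ∷_) Is))
  ≡⟨ length-++ (filter P? (map (outside ∷_) Is)) ⟩
    length (filter P? (map (outside ∷_) Is)) + length (filter P? (map (inside ∷_) Is))
  ≡⟨ cong₂ _+_ (length-filter-map P? (outside ∷_) Is) (length-filter-map P? (inside ∷_) Is) ⟩
    N ds V + length (filter (λ I → d + vol ds I ≟ V) Is)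
  ∎
  where
  open ≡-Reasoning
  Is : List (Subset k)
  Is = allSubsets k
  P? : Decidable (λ I → vol (d ∷ ds) I ≡ V)
  P? I = vol (d ∷ ds) I ≟ V

N-∷-< : ∀ {k} {d} (ds : Vec ℕ k) {V} → V < d → N (d ∷ ds) V ≡ N ds V
N-∷-< {k} {d} ds {V} V<d = begin
    N (d ∷ ds) V
  ≡⟨ N-∷ d ds V ⟩
    N ds V + length (filter (λ I → d + vol ds I ≟ V) (allSubsets k))
  ≡⟨ cong (λ xs → N ds V + length xs) (filter-none _ (universal d+vol≢V (allSubsets k))) ⟩
    N ds V + 0
  ≡⟨ +-identityʳ (N ds V) ⟩
    N ds V
  ∎
  where
  open ≡-Reasoning
  d+vol≢V : ∀ I → d + vol ds I ≡ V → ⊥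
  d+vol≢V I eq = <⇒≱ V<d (subst (d ≤_) eq (m≤m+n d (vol ds I)))

N-∷-≥ : ∀ {k} {d} (ds : Vec ℕ k) {V} → d ≤ V → N (d ∷ ds) V ≡ N ds V + N ds (V ∸ d)
N-∷-≥ {k} {d} ds {V} d≤V = trans (N-∷ d ds V)
  (cong (λ xs → N ds V + length xs) (filter-≐ _ _ (shift⁻ , shift⁺) (allSubsets k)))
  where
  shift⁻ : ∀ {I} → d + vol ds I ≡ V → vol ds I ≡ V ∸ d
  shift⁻ eq = +-cancelˡ-≡ d _ _ (trans eq (sym (m+[n∸m]≡n d≤V)))
  shift⁺ : ∀ {I} → vol ds I ≡ V ∸ d → d + vol ds I ≡ V
  shift⁺ eq = trans (cong (d +_) eq) (m+[n∸m]≡n d≤V)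

N[0]≡1 : ∀ {k} (ds : Vec ℕ k) → All (0 <_) ds → N ds 0 ≡ 1
N[0]≡1 []       []           = refl
N[0]≡1 (d ∷ ds) (d>0 ∷ ds>0) = trans (N-∷-< ds d>0) (N[0]≡1 ds ds>0)

N≤binomialSum : ∀ {k} (ds : Vec ℕ k) → All (3 ≤_) ds → ∀ {V} → 0 < V → N ds V ≤ binomialSum k (V / 3)
N≤binomialSum []       []           {suc V} _ = z≤n
N≤binomialSum {suc k} (d ∷ ds) (d≥3 ∷ ds≥3) {V} V>0 with V <? d
... | yes V<d = begin
    N (d ∷ ds) V
  ≡⟨ N-∷-< ds V<d ⟩
    N ds V
  ≤⟨ N≤binomialSum ds ds≥3 V>0 ⟩
    binomialSum k (V / 3)
  ≤⟨ binomialSum-monoˡ-≤ (V / 3) (n≤1+n k) ⟩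
    binomialSum (suc k) (V / 3)
  ∎
  where open ≤-Reasoning
... | no V≮d = begin
    N (d ∷ ds) V
  ≡⟨ N-∷-≥ ds d≤V ⟩
    N ds V + N ds (V ∸ d)
  ≤⟨ +-mono-≤ (N≤binomialSum ds ds≥3 V>0) (N-below (V ∸ d) (∸-monoʳ-≤ V d≥3)) ⟩
    binomialSum k (V / 3) + suc (binomialSum k m)
  ≡⟨ cong (λ j → binomialSum k j + suc (binomialSum k m)) V/3≡1+m ⟩
    binomialSum k (suc m) + suc (binomialSum k m)
  ≡⟨ sym (binomialSum-pascal k m) ⟩
    binomialSum (suc k) (suc m)
  ≡⟨ cong (binomialSum (suc k)) (sym V/3≡1+m) ⟩
    binomialSum (suc k) (V / 3)
  ∎
  where
  open ≤-Reasoning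
  d≤V : d ≤ V
  d≤V = ≮⇒≥ V≮d
  m : ℕ
  m = (V ∸ 3) / 3
  V/3≡1+m : V / 3 ≡ suc m
  V/3≡1+m = m/n≡1+[m∸n]/n (≤-trans d≥3 d≤V)
  N-below : ∀ U → U ≤ V ∸ 3 → N ds U ≤ suc (binomialSum k m)
  -- the empty subset is paid for by the term C(k, 0) = 1 of Pascal's rule
  N-below zero    _ = ≤-trans (≤-reflexive (N[0]≡1 ds (All.map (≤-trans (s≤s z≤n)) ds≥3))) (s≤s z≤n)
  N-below (suc U) U≤V∸3 = m≤n⇒m≤1+n (≤-trans (N≤binomialSum ds ds≥3 (s≤s z≤n))
                                            (binomialSum-monoʳ-≤ k (/-monoˡ-≤ 3 U≤V∸3)))

All[c≤]⇒k*c≤sum : ∀ {c k} (xs : Vec ℕ k) → All (c ≤_) xs → k * c ≤ sum xs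
All[c≤]⇒k*c≤sum []       []           = z≤n
All[c≤]⇒k*c≤sum (x ∷ xs) (c≤x ∷ c≤xs) = +-mono-≤ c≤x (All[c≤]⇒k*c≤sum xs c≤xs)

lemma4 : (k n : ℕ) (d : Vec ℕ k) → All (λ di → 3 ≤ di) d → sum d ≡ 2 * n →
         (V : ℕ) → 0 < V → V ≤ n →
         N d V ≤ (V / 3) * ((2 * n / 3) C (V / 3))
lemma4 k n d d≥3 Σd≡2n V V>0 V≤n = begin
    N d V
  ≤⟨ N≤binomialSum d d≥3 V>0 ⟩
    binomialSum k (V / 3)
  ≤⟨ binomialSum-monoˡ-≤ (V / 3) k≤2n/3 ⟩
    binomialSum (2 * n / 3) (V / 3)
  ≤⟨ binomialSum≤m*nCm (V / 3) 2[V/3]≤2n/3 ⟩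
    (V / 3) * ((2 * n / 3) C (V / 3))
  ∎
  where
  open ≤-Reasoning
  k≤2n/3 : k ≤ 2 * n / 3
  k≤2n/3 = subst (_≤ 2 * n / 3) (m*n/n≡m k 3)
    (/-monoˡ-≤ 3 (subst (k * 3 ≤_) Σd≡2n (All[c≤]⇒k*c≤sum d d≥3)))
  2[V/3]≤2n/3 : 2 * (V / 3) ≤ 2 * n / 3
  2[V/3]≤2n/3 = subst (_≤ 2 * n / 3) (m*n/n≡m (2 * (V / 3)) 3)
    (/-monoˡ-≤ 3 (subst (_≤ 2 * n) (sym (*-assoc 2 (V / 3) 3))
      (*-monoʳ-≤ 2 (≤-trans (m/n*n≤m V 3) V≤n))))
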